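{- Let $h:\mathbf F_{\mathsf V}(z)\to\prod_{k=1}^m\mathbf E_k$ be an algebraic e-generalization problem for a variety $\mathsf V$. If $\prod_{k=1}^m\mathbf E_k$ is finitely generated and projective in $\mathsf V$, then the type of $h$ is unitary and $h$ is the minimum of $(\mathscr A(h),\sqsubseteq)$.
   Context: $\mathbf F_{\mathsf V}(z)$ is the 1-generated free algebra of $\mathsf V$. Projective = retract of a free algebra; exact = isomorphic to a finitely generated subalgebra of a finitely generated free algebra. An algebraic e-generalization problem is a homomorphism $h:\mathbf F_{\mathsf V}(z)\to\prod_{k=1}^m\mathbf E_k$ ($m\ge1$), each $\mathbf E_k$ 1-generated exact, each $p_k\circ h$ surjective. A solution is a homomorphism $g:\mathbf F_{\mathsf V}(z)\to\mathbf P$, $\mathbf P$ finitely generated projective, with $f\circ g=h$ for some homomorphism $f$. $g\sqsubseteq g'$ iff $f\circ g'=g$ for some homomorphism $f$; $(\mathscr A(h),\sqsubseteq)$ is the poset of solutions modulo equal generality. The type of $h$ is unitary if this poset has a minimal complete set (pairwise incomparable elements such that every element lies above one of them) of cardinality 1. -}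

module Defs where

open import Data.Nat using (ℕ; _≤_)
open import Data.Fin using (Fin)
open import Data.Unit using (⊤)
open import Data.Product using (Σ; Σ-syntax; _×_; _,_; proj₁; proj₂)
open import Relation.Nullary using (¬_)
open import Relation.Binary using (Rel; IsEquivalence)
open import Relation.Binary.PropositionalEquality using (_≡_)

record Signature : Set₁ where
  field
    Op    : Set
    arity : Op → ℕ
open Signature public

data Term (σ : Signature) (X : Set) : Set where
  var : X → Term σ X
  op  : (o : Op σ) → (Fin (arity σ o) → Term σ X) → Term σ X

subst : ∀ {σ X Y} → (X → Term σ Y) → Term σ X → Term σ Y
subst s (var x)   = s x
subst s (op o ts) = op o (λ i → subst s (ts i))

record Algebra (σ : Signature) : Set₁ where
  field
    Carrier : Set
    _≈_     : Rel Carrier _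
    isEquiv : IsEquivalence _≈_
    ⟦_⟧     : (o : Op σ) → (Fin (arity σ o) → Carrier) → Carrier
    ⟦⟧-cong : ∀ o {as bs} → (∀ i → as i ≈ bs i) → ⟦ o ⟧ as ≈ ⟦ o ⟧ bs
open Algebra public

eval : ∀ {σ X} (A : Algebra σ) → (X → Carrier A) → Term σ X → Carrier A
eval A ρ (var x)   = ρ x
eval A ρ (op o ts) = ⟦ A ⟧ o (λ i → eval A ρ (ts i))

record Hom {σ} (A B : Algebra σ) : Set where
  field
    fun      : Carrier A → Carrier B
    fun-cong : ∀ {a b} → _≈_ A a b → _≈_ B (fun a) (fun b)
    preserve : ∀ o as → _≈_ B (fun (⟦ A ⟧ o as)) (⟦ B ⟧ o (λ i → fun (as i)))
open Hom public

_∘ₕ_ : ∀ {σ} {A B C : Algebra σ} → Hom B C → Hom A B → Hom A C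
_∘ₕ_ {C = C} g f = record
  { fun      = λ a → fun g (fun f a)
  ; fun-cong = λ p → fun-cong g (fun-cong f p)
  ; preserve = λ o as → IsEquivalence.trans (isEquiv C)
                 (fun-cong g (preserve f o as)) (preserve g o (λ i → fun f (as i)))
  }

_≗ₕ_ : ∀ {σ} {A B : Algebra σ} → Hom A B → Hom A B → Set
_≗ₕ_ {B = B} f g = ∀ a → _≈_ B (fun f a) (fun g a)

Surjective : ∀ {σ} {A B : Algebra σ} → Hom A B → Set
Surjective {A = A} {B} f = ∀ b → Σ[ a ∈ Carrier A ] _≈_ B (fun f a) b

record Iso {σ} (A B : Algebra σ) : Set where
  field
    to     : Hom A B
    from   : Hom B A
    from∘to : ∀ a → _≈_ A (fun from (fun to a)) a
    to∘from : ∀ b → _≈_ B (fun to (fun from b)) b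

-- A variety is given by a set of identities between terms in
-- countably many variables (Birkhoff: varieties = equational classes).
record Variety (σ : Signature) : Set₁ where
  field
    Eqn : Set
    lhs : Eqn → Term σ ℕ
    rhs : Eqn → Term σ ℕ
open Variety public

_∈V_ : ∀ {σ} → Algebra σ → Variety σ → Set
A ∈V V = ∀ e (ρ : ℕ → Carrier A) → _≈_ A (eval A ρ (lhs V e)) (eval A ρ (rhs V e))

data Deriv {σ} (V : Variety σ) (X : Set) : Term σ X → Term σ X → Set where
  d-refl  : ∀ {t} → Deriv V X t t
  d-sym   : ∀ {t s} → Deriv V X t s → Deriv V X s t
  d-trans : ∀ {t s u} → Deriv V X t s → Deriv V X s u → Deriv V X t u
  d-cong  : ∀ o {ts ss} → (∀ i → Deriv V X (ts i) (ss i)) → Deriv V X (op o ts) (op o ss)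
  d-ax    : ∀ e (s : ℕ → Term σ X) → Deriv V X (subst s (lhs V e)) (subst s (rhs V e))

F : ∀ {σ} → Variety σ → Set → Algebra σ
F {σ} V X = record
  { Carrier = Term σ X
  ; _≈_     = Deriv V X
  ; isEquiv = record { refl = d-refl ; sym = d-sym ; trans = d-trans }
  ; ⟦_⟧     = op
  ; ⟦⟧-cong = d-cong
  }

GeneratedBy : ∀ {σ} → ℕ → Algebra σ → Set
GeneratedBy {σ} n A =
  Σ[ g ∈ (Fin n → Carrier A) ] (∀ a → Σ[ t ∈ Term σ (Fin n) ] _≈_ A (eval A g t) a)

FinitelyGenerated : ∀ {σ} → Algebra σ → Set
FinitelyGenerated A = Σ[ n ∈ ℕ ] GeneratedBy n A

-- projective = retract of a free algebra of V
Projective : ∀ {σ} → Variety σ → Algebra σ → Set₁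
Projective V A =
  Σ[ X ∈ Set ] Σ[ i ∈ Hom A (F V X) ] Σ[ r ∈ Hom (F V X) A ]
    (∀ a → _≈_ A (fun r (fun i a)) a)

record Subuniverse {σ} (B : Algebra σ) : Set₁ where
  field
    Mem    : Carrier B → Set
    closed : ∀ o (as : Fin (arity σ o) → Carrier B) → (∀ i → Mem (as i)) → Mem (⟦ B ⟧ o as)
open Subuniverse public

Sub : ∀ {σ} (B : Algebra σ) → Subuniverse B → Algebra σ
Sub {σ} B S = record
  { Carrier = Σ (Carrier B) (Mem S)
  ; _≈_     = λ a b → _≈_ B (proj₁ a) (proj₁ b)
  ; isEquiv = record { refl  = IsEquivalence.refl (isEquiv B)
                     ; sym   = IsEquivalence.sym (isEquiv B)
                     ; trans = IsEquivalence.trans (isEquiv B) }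
  ; ⟦_⟧     = λ o as → ⟦ B ⟧ o (λ i → proj₁ (as i)) , closed S o _ (λ i → proj₂ (as i))
  ; ⟦⟧-cong = λ o p → ⟦⟧-cong B o p
  }

Exact : ∀ {σ} → Variety σ → Algebra σ → Set₁
Exact V A =
  Σ[ n ∈ ℕ ] Σ[ S ∈ Subuniverse (F V (Fin n)) ]
    (FinitelyGenerated (Sub (F V (Fin n)) S) × Iso A (Sub (F V (Fin n)) S))

Π : ∀ {σ m} → (Fin m → Algebra σ) → Algebra σ
Π {σ} {m} E = record
  { Carrier = (k : Fin m) → Carrier (E k)
  ; _≈_     = λ a b → ∀ k → _≈_ (E k) (a k) (b k)
  ; isEquiv = record { refl  = λ k → IsEquivalence.refl (isEquiv (E k))
                     ; sym   = λ p k → IsEquivalence.sym (isEquiv (E k)) (p k)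
                     ; trans = λ p q k → IsEquivalence.trans (isEquiv (E k)) (p k) (q k) }
  ; ⟦_⟧     = λ o as k → ⟦ E k ⟧ o (λ i → as i k)
  ; ⟦⟧-cong = λ o p k → ⟦⟧-cong (E k) o (λ i → p i k)
  }

proj : ∀ {σ m} (E : Fin m → Algebra σ) (k : Fin m) → Hom (Π E) (E k)
proj E k = record
  { fun = λ a → a k ; fun-cong = λ p → p k
  ; preserve = λ o as → IsEquivalence.refl (isEquiv (E k)) }

-- F_V(z): the 1-generated free algebra
Fz : ∀ {σ} → Variety σ → Algebra σ
Fz V = F V ⊤

record IsEGenProblem {σ} (V : Variety σ) {m : ℕ} (E : Fin m → Algebra σ)
                     (h : Hom (Fz V) (Π E)) : Set₁ where
  field
    m≥1       : 1 ≤ m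
    oneGen    : ∀ k → GeneratedBy 1 (E k)
    exact     : ∀ k → Exact V (E k)
    surjective : ∀ k → Surjective (proj E k ∘ₕ h)

IsSolution : ∀ {σ} (V : Variety σ) {m} (E : Fin m → Algebra σ)
             (h : Hom (Fz V) (Π E)) (P : Algebra σ) (g : Hom (Fz V) P) → Set₁
IsSolution V E h P g =
  FinitelyGenerated P × Projective V P × (Σ[ f ∈ Hom P (Π E) ] ((f ∘ₕ g) ≗ₕ h))

record Solution {σ} (V : Variety σ) {m} (E : Fin m → Algebra σ)
                (h : Hom (Fz V) (Π E)) : Set₂ where
  field
    P   : Algebra σ
    g   : Hom (Fz V) P
    sol : IsSolution V E h P g
open Solution public

_⊑_ : ∀ {σ} {V : Variety σ} → {P P' : Algebra σ} → Hom (Fz V) P → Hom (Fz V) P' → Set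
_⊑_ {P = P} {P'} g g' = Σ[ f ∈ Hom P' P ] ((f ∘ₕ g') ≗ₕ g)

_⊑ₛ_ : ∀ {σ} {V : Variety σ} {m} {E : Fin m → Algebra σ} {h : Hom (Fz V) (Π E)} →
       Solution V E h → Solution V E h → Set
_⊑ₛ_ {V = V} s s' = _⊑_ {V = V} (g s) (g s')

record MinimalCompleteSet {σ} (V : Variety σ) {m} (E : Fin m → Algebra σ)
                          (h : Hom (Fz V) (Π E)) (I : Set) : Set₂ where
  field
    elem         : I → Solution V E h
    incomparable : ∀ i j → ¬ (i ≡ j) → ¬ (_⊑ₛ_ {E = E} {h = h} (elem i) (elem j))
    complete     : ∀ s → Σ[ i ∈ I ] (_⊑ₛ_ {E = E} {h = h} (elem i) s)

Unitary : ∀ {σ} (V : Variety σ) {m} (E : Fin m → Algebra σ)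
          (h : Hom (Fz V) (Π E)) → Set₂
Unitary V E h = MinimalCompleteSet V E h (Fin 1)

IsMinimum : ∀ {σ} (V : Variety σ) {m} (E : Fin m → Algebra σ)
            (h : Hom (Fz V) (Π E)) (P : Algebra σ) (g : Hom (Fz V) P) → Set₂
IsMinimum V E h P g = IsSolution V E h P g × (∀ (s : Solution V E h) → _⊑_ {V = V} g (Solution.g s))

-- The codomain of h is itself finitely generated and projective, so h
-- (with the identity as witness) is a solution; and any solution g comes
-- with f such that f ∘ g = h, which says precisely h ⊑ g.  Hence h is the
-- minimum of the solution poset, and {h} is a minimal complete set.
-- None of the conditions making h an e-generalization problem are used.
module Submission where

open import Defs
open import Data.Nat using (ℕ)
open import Data.Fin using (Fin; zero)
open import Data.Product using (_×_; _,_; proj₂)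
open import Relation.Binary using (IsEquivalence)
open import Relation.Binary.PropositionalEquality using (refl)

idₕ : ∀ {σ} (A : Algebra σ) → Hom A A
idₕ A = record
  { fun      = λ a → a
  ; fun-cong = λ p → p
  ; preserve = λ o as → IsEquivalence.refl (isEquiv A)
  }

module _ {σ} (V : Variety σ) {m} (E : Fin m → Algebra σ) (h : Hom (Fz V) (Π E)) where

  problem-isSolution : FinitelyGenerated (Π E) → Projective V (Π E) →
                       IsSolution V E h (Π E) h
  problem-isSolution fg pr =
    fg , pr , idₕ (Π E) , λ a → IsEquivalence.refl (isEquiv (Π E))

  problem-⊑-solution : (s : Solution V E h) → _⊑_ {V = V} h (g s)
  problem-⊑-solution s = proj₂ (proj₂ (sol s))

  minimum⇒unitary : ∀ P (g : Hom (Fz V) P) → IsMinimum V E h P g → Unitary V E h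
  minimum⇒unitary P g (isSol , least) = record
    { elem         = λ _ → record { P = P ; g = g ; sol = isSol }
    ; incomparable = λ { zero zero 0≢0 _ → 0≢0 refl }
    ; complete     = λ s → zero , least s
    }

theorem4p24 : (σ : Signature) (V : Variety σ) (m : ℕ) (E : Fin m → Algebra σ)
              (h : Hom (Fz V) (Π E)) →
              IsEGenProblem V E h →
              FinitelyGenerated (Π E) →
              Projective V (Π E) →
              Unitary V E h × IsMinimum V E h (Π E) h
theorem4p24 σ V m E h _ fg pr = minimum⇒unitary V E h (Π E) h minimum , minimum
  where
  minimum : IsMinimum V E h (Π E) h
  minimum = problem-isSolution V E h fg pr , problem-⊑-solution V E h
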